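{- For every integer $n\ge 1$ and all integers $x_1,\dots,x_n$ (equivalently, as polynomials in $x_1,\dots,x_n$), $G_n(x_1,\dots,x_n)=F_n(x_1,\dots,x_n)$.
   Context: The functions $F_n$ are defined recursively by $F_1(x_1)=x_1$ and, for $i\ge 1$, $F_{i+1}(x_1,\dots,x_i,x_{i+1})=F_i(x_1,\dots,x_{i-1},x_i-1)+(x_{i+1}-1)\cdot F_i(x_1,\dots,x_i)$. For non-negative integers $i,j$, let $C_{i,j}$ be the set of subsets $I\subseteq\{1,\dots,j\}$ with $|I|=i$ such that (a) whenever $a<b$ are elements of $I$ with no element of $I$ strictly between them, $b-a$ is odd, and (b) $j-\max(I)$ is even, with the convention $\max(\emptyset)=0$. Define $\gamma_{i,j}(x_1,\dots,x_j)=\sum_{I\in C_{i,j}}\prod_{m\in I}x_m$ (the empty product being $1$, and the empty sum $0$). Define $G_n(x_1,\dots,x_n)=\gamma_{n,n}-\gamma_{n-2,n}+\gamma_{n-4,n}-\gamma_{n-6,n}+\cdots$, the sum continuing as long as the first subscript is non-negative, i.e. $G_n=\sum_{0\le m\le n/2}(-1)^m\gamma_{n-2m,n}$. -}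

module Defs where

open import Data.Nat as ℕ using (ℕ; zero; suc; _∸_; _%_)
open import Data.Integer as ℤ using (ℤ; +_; _+_; _*_; _-_; -_)
open import Data.Fin as Fin using (Fin; toℕ; fromℕ; inject₁)
open import Data.Fin.Subset using (Subset; inside; outside; ∣_∣)
open import Data.Fin.Subset.Properties using (_∈?_)
open import Data.List as List using (List; []; _∷_; filter; map; allFin; upTo)
open import Data.Vec using (_∷_; [])
open import Data.Bool using (Bool; true; false; if_then_else_)
open import Relation.Nullary using (Dec; yes; no; ¬?)
open import Relation.Nullary.Decidable using (_×-dec_; ⌊_⌋)
open import Relation.Binary.PropositionalEquality using (_≡_)
open import Data.Product using (_×_)
open import Data.Unit using (⊤)

-- The functions F_n.  Arguments (x_1,…,x_n) are a function Fin n → ℤ,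
-- with x_k = x (k-1).  We write  F (suc i) x  for F_{i+1}(x_1,…,x_{i+1}).

init : ∀ {i} → (Fin (suc i) → ℤ) → (Fin i → ℤ)
init x k = x (inject₁ k)

lastArg : ∀ {i} → (Fin (suc i) → ℤ) → ℤ
lastArg {i} x = x (fromℕ i)

decLast : ∀ {i} → (Fin (suc i) → ℤ) → (Fin (suc i) → ℤ)
decLast {i} x k with toℕ k ℕ.≟ i
... | yes _ = x k - + 1
... | no  _ = x k

-- F' i x = F_{i+1}(x_1,…,x_{i+1})
F' : (i : ℕ) → (Fin (suc i) → ℤ) → ℤ
F' zero    x = x Fin.zero
F' (suc i) x = F' i (decLast (init x)) + (lastArg x - + 1) * F' i (init x)

-- F n is F_n for n ≥ 1 (F 0 is a junk value 0, never used)
F : (n : ℕ) → (Fin n → ℤ) → ℤ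
F zero    x = + 0
F (suc i) x = F' i x

-- all subsets of Fin j (i.e. of {1,…,j}, element k ↔ k+1)
allSubsets : (j : ℕ) → List (Subset j)
allSubsets zero    = [] ∷ []
allSubsets (suc j) =
  map (inside ∷_) (allSubsets j) List.++ map (outside ∷_) (allSubsets j)

elems : ∀ {j} → Subset j → List ℕ
elems {j} I = map (λ k → suc (toℕ k)) (filter (_∈? I) (allFin j))

Odd Even : ℕ → Set
Odd  k = k % 2 ≡ 1
Even k = k % 2 ≡ 0

ConsecOdd : List ℕ → Set
ConsecOdd []           = ⊤
ConsecOdd (a ∷ [])     = ⊤
ConsecOdd (a ∷ b ∷ bs) = Odd (b ∸ a) × ConsecOdd (b ∷ bs)

consecOdd? : (l : List ℕ) → Dec (ConsecOdd l)
consecOdd? []           = yes _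
consecOdd? (a ∷ [])     = yes _
consecOdd? (a ∷ b ∷ bs) = ((b ∸ a) % 2 ℕ.≟ 1) ×-dec consecOdd? (b ∷ bs)

-- maximum of an increasing list, with max ∅ = 0
maxL : List ℕ → ℕ
maxL []       = 0
maxL (a ∷ as) = a ℕ.⊔ maxL as

InC : (i j : ℕ) → Subset j → Set
InC i j I = (∣ I ∣ ≡ i) × ConsecOdd (elems I) × Even (j ∸ maxL (elems I))

inC? : (i j : ℕ) → (I : Subset j) → Dec (InC i j I)
inC? i j I = (∣ I ∣ ℕ.≟ i) ×-dec consecOdd? (elems I) ×-dec ((j ∸ maxL (elems I)) % 2 ℕ.≟ 0)

C : (i j : ℕ) → List (Subset j)
C i j = filter (inC? i j) (allSubsets j)

prodOver : ∀ {j} → (Fin j → ℤ) → Subset j → ℤ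
prodOver {j} x I = List.foldr _*_ (+ 1) (map x (filter (_∈? I) (allFin j)))

sumℤ : List ℤ → ℤ
sumℤ = List.foldr _+_ (+ 0)

γ : (i j : ℕ) → (Fin j → ℤ) → ℤ
γ i j x = sumℤ (map (prodOver x) (C i j))

sgn : ℕ → ℤ
sgn zero    = + 1
sgn (suc m) = - sgn m

G : (n : ℕ) → (Fin n → ℤ) → ℤ
G n x = sumℤ (map (λ m → sgn m * γ (n ∸ (2 ℕ.* m)) n x) (upTo (suc (n ℕ./ 2))))

-- Both G_n and F_n equal the continuant K_n(x_1,…,x_n).
-- The continuant also satisfies the mirrored recurrence in the last variable, and it is affine in x_n with
-- slope K_{n-1}(x_1,…,x_{n-1}); together these turn the recursion defining F into K's.
-- For G: when i ≡ n (mod 2), I ∈ C_{i,n} says exactly that {1,…,n} ∖ I splits into pairs {m, m+1}, so G_n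
-- is a signed sum over monomer–dimer tilings, and splitting on whether 1 ∈ I (and then 2 ∈ I) gives K's
-- recurrence. The parity bookkeeping rests on the least element of I ∈ C_{k,j} being ≡ j + k + 1.

module Submission where

open import Defs
open import Data.Nat as ℕ using (ℕ; zero; suc; _∸_; _<_; _≤_; parity)
import Data.Nat.Properties as ℕP
open import Data.Nat.DivMod using (m/n≡1+[m∸n]/n)
open import Data.Parity.Base as ℙ using (Parity; 0ℙ; 1ℙ; _⁻¹)
import Data.Parity.Properties as ℙP
open import Data.Integer using (ℤ; +_; _+_; _*_; _-_; -_)
import Data.Integer.Properties as ℤP
open import Data.Integer.Tactic.RingSolver using (solve-∀)
open import Data.Fin as Fin using (Fin; toℕ; fromℕ; inject₁)
import Data.Fin.Properties as FinP
open import Data.Fin.Subset using (Subset; inside; outside; ∣_∣)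
open import Data.Fin.Subset.Properties using (_∈?_; ∣p∣≤n)
open import Data.Vec using (_∷_; [])
open import Data.Vec.Functional using (head; tail)
open import Data.List as List using (List; []; _∷_; filter; map; allFin; length; _++_; upTo)
import Data.List.Properties as LP
open import Data.List.Relation.Unary.All using (universal)
open import Data.Product using (_×_; _,_; proj₁; proj₂)
open import Data.Unit using (tt)
open import Data.Bool using (true; false)
open import Function using (_∘_; id)
open import Relation.Nullary using (¬_; does; yes; no)
open import Data.Empty using (⊥-elim)
open import Relation.Unary using (Decidable; _≐_)
open import Relation.Binary.PropositionalEquality
  using (_≡_; refl; sym; trans; cong; cong₂; subst; module ≡-Reasoning)

continuant : ∀ n → (Fin n → ℤ) → ℤ
continuant zero          x = + 1
continuant (suc zero)    x = head x
continuant (suc (suc n)) x = head x * continuant (suc n) (tail x) - continuant n (tail (tail x))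

continuant-cong : ∀ n {x y : Fin n → ℤ} → (∀ k → x k ≡ y k) → continuant n x ≡ continuant n y
continuant-cong zero          x≗y = refl
continuant-cong (suc zero)    x≗y = x≗y Fin.zero
continuant-cong (suc (suc n)) x≗y =
  cong₂ _-_ (cong₂ _*_ (x≗y Fin.zero) (continuant-cong (suc n) (x≗y ∘ Fin.suc)))
            (continuant-cong n (x≗y ∘ Fin.suc ∘ Fin.suc))

continuant-last : ∀ n (x : Fin (suc (suc n)) → ℤ) →
  continuant (suc (suc n)) x ≡ lastArg x * continuant (suc n) (init x) - continuant n (init (init x))
continuant-last zero          x = cong (_- + 1) (ℤP.*-comm (head x) (lastArg x))
continuant-last (suc zero)    x = ring (x Fin.zero) (x (Fin.suc Fin.zero)) (lastArg x)
  where
  ring : ∀ a b c → a * (b * c - + 1) - c ≡ c * (a * b - + 1) - a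
  ring = solve-∀
continuant-last (suc (suc n)) x =
  trans (cong₂ (λ a b → head x * a - b) (continuant-last (suc n) (tail x))
                                        (continuant-last n (tail (tail x))))
        (ring (head x) (lastArg x) _ _ _ _)
  where
  ring : ∀ a l A B C D → a * (l * A - B) - (l * C - D) ≡ l * (a * A - C) - (a * B - D)
  ring = solve-∀

decLast-last : ∀ {n} (x : Fin (suc n) → ℤ) → decLast x (fromℕ n) ≡ lastArg x - + 1
decLast-last {n} x with toℕ (fromℕ n) ℕ.≟ n
... | yes _ = refl
... | no ne = ⊥-elim (ne (FinP.toℕ-fromℕ n))

decLast-inject₁ : ∀ {n} (x : Fin (suc n) → ℤ) (k : Fin n) → decLast x (inject₁ k) ≡ x (inject₁ k)
decLast-inject₁ {n} x k with toℕ (inject₁ k) ℕ.≟ n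
... | no _ = refl
... | yes eq = ⊥-elim (ℕP.<-irrefl eq (subst (_< n) (sym (FinP.toℕ-inject₁ k)) (FinP.toℕ<n k)))

continuant-decLast : ∀ n (x : Fin (suc n) → ℤ) →
  continuant (suc n) (decLast x) ≡ continuant (suc n) x - continuant n (init x)
continuant-decLast zero    x = refl
continuant-decLast (suc n) x = begin
  continuant (suc (suc n)) (decLast x)
    ≡⟨ continuant-last n (decLast x) ⟩
  lastArg (decLast x) * continuant (suc n) (init (decLast x)) - continuant n (init (init (decLast x)))
    ≡⟨ cong₂ (λ a b → a * continuant (suc n) (init (decLast x)) - b) (decLast-last x)
             (continuant-cong n (decLast-inject₁ x ∘ inject₁)) ⟩
  (lastArg x - + 1) * continuant (suc n) (init (decLast x)) - K₀
    ≡⟨ cong (λ b → (lastArg x - + 1) * b - K₀) (continuant-cong (suc n) (decLast-inject₁ x)) ⟩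
  (lastArg x - + 1) * K₁ - K₀
    ≡⟨ ring (lastArg x) K₁ K₀ ⟩
  (lastArg x * K₁ - K₀) - K₁
    ≡⟨ cong (_- K₁) (continuant-last n x) ⟨
  continuant (suc (suc n)) x - K₁
    ∎
  where
  open ≡-Reasoning
  K₁ = continuant (suc n) (init x)
  K₀ = continuant n (init (init x))
  ring : ∀ l A B → (l - + 1) * A - B ≡ (l * A - B) - A
  ring = solve-∀

F'≡continuant : ∀ n (x : Fin (suc n) → ℤ) → F' n x ≡ continuant (suc n) x
F'≡continuant zero    x = refl
F'≡continuant (suc n) x = begin
  F' n (decLast (init x)) + (lastArg x - + 1) * F' n (init x)
    ≡⟨ cong₂ (λ a b → a + (lastArg x - + 1) * b)
             (trans (F'≡continuant n (decLast (init x))) (continuant-decLast n (init x)))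
             (F'≡continuant n (init x)) ⟩
  (K₁ - K₀) + (lastArg x - + 1) * K₁
    ≡⟨ ring (lastArg x) K₁ K₀ ⟩
  lastArg x * K₁ - K₀
    ≡⟨ continuant-last n x ⟨
  continuant (suc (suc n)) x
    ∎
  where
  open ≡-Reasoning
  K₁ = continuant (suc n) (init x)
  K₀ = continuant n (init (init x))
  ring : ∀ l A B → (A - B) + (l - + 1) * A ≡ l * A - B
  ring = solve-∀

parity-suc : ∀ n → parity (suc n) ≡ parity n ⁻¹
parity-suc n = trans (sym (ℙP.⁻¹-involutive (parity (suc n)))) (cong _⁻¹ (ℙP.suc-homo-⁻¹ n))

parity-suc-+ : ∀ m n → parity (suc (m ℕ.+ n)) ≡ (parity m ℙ.+ parity n) ⁻¹
parity-suc-+ m n = trans (parity-suc (m ℕ.+ n)) (cong _⁻¹ (ℙP.+-homo-+ m n))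

Odd⇒parity≡1ℙ : ∀ n → Odd n → parity n ≡ 1ℙ
Odd⇒parity≡1ℙ (suc zero)    _ = refl
Odd⇒parity≡1ℙ (suc (suc n)) o = Odd⇒parity≡1ℙ n o

parity≡1ℙ⇒Odd : ∀ n → parity n ≡ 1ℙ → Odd n
parity≡1ℙ⇒Odd (suc zero)    _ = refl
parity≡1ℙ⇒Odd (suc (suc n)) p = parity≡1ℙ⇒Odd n p

Even⇒parity≡0ℙ : ∀ n → Even n → parity n ≡ 0ℙ
Even⇒parity≡0ℙ zero          _ = refl
Even⇒parity≡0ℙ (suc (suc n)) e = Even⇒parity≡0ℙ n e

-- The empty list gets parity 1ℙ so that headParity-elems below also covers I = ∅.
headParity : List ℕ → Parity
headParity []      = 1ℙ
headParity (a ∷ _) = parity a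

headParity-map-suc : ∀ {k} (l : List ℕ) → length l ≡ suc k → headParity (map suc l) ≡ headParity l ⁻¹
headParity-map-suc (a ∷ _) _ = parity-suc a

ConsecOdd-map-suc : ∀ l → ConsecOdd (map suc l) ≡ ConsecOdd l
ConsecOdd-map-suc []           = refl
ConsecOdd-map-suc (a ∷ [])     = refl
ConsecOdd-map-suc (a ∷ b ∷ bs) = cong (Odd (b ∸ a) ×_) (ConsecOdd-map-suc (b ∷ bs))

ConsecOdd-1∷⁻ : ∀ l → ConsecOdd (1 ∷ map suc l) → headParity l ≡ 1ℙ × ConsecOdd l
ConsecOdd-1∷⁻ []      _        = refl , tt
ConsecOdd-1∷⁻ (a ∷ l) (odd , c) = Odd⇒parity≡1ℙ a odd , subst id (ConsecOdd-map-suc (a ∷ l)) c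

ConsecOdd-1∷⁺ : ∀ l → headParity l ≡ 1ℙ → ConsecOdd l → ConsecOdd (1 ∷ map suc l)
ConsecOdd-1∷⁺ []      _ _ = tt
ConsecOdd-1∷⁺ (a ∷ l) p c = parity≡1ℙ⇒Odd a p , subst id (sym (ConsecOdd-map-suc (a ∷ l))) c

maxL-map-suc : ∀ a l → maxL (map suc (a ∷ l)) ≡ suc (maxL (a ∷ l))
maxL-map-suc a []      = cong suc (sym (ℕP.⊔-identityʳ a))
maxL-map-suc a (b ∷ l) = cong (suc a ℕ.⊔_) (maxL-map-suc b l)

∸-maxL-map-suc : ∀ {k} j (l : List ℕ) → length l ≡ suc k → suc j ∸ maxL (map suc l) ≡ j ∸ maxL l
∸-maxL-map-suc j (a ∷ l) _ = cong (suc j ∸_) (maxL-map-suc a l)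

∸-maxL-1∷ : ∀ j l → suc j ∸ maxL (1 ∷ map suc l) ≡ j ∸ maxL l
∸-maxL-1∷ j []      = refl
∸-maxL-1∷ j (a ∷ l) = cong (λ m → suc j ∸ (1 ℕ.⊔ m)) (maxL-map-suc a l)

members : ∀ {j} → Subset j → List (Fin j)
members {j} I = filter (_∈? I) (allFin j)

filter-∈?-map-suc : ∀ {j} b (I : Subset j) (ks : List (Fin j)) →
  filter (_∈? (b ∷ I)) (map Fin.suc ks) ≡ map Fin.suc (filter (_∈? I) ks)
filter-∈?-map-suc b I []       = refl
filter-∈?-map-suc b I (k ∷ ks) with does (k ∈? I)
... | true  = cong (Fin.suc k ∷_) (filter-∈?-map-suc b I ks)
... | false = filter-∈?-map-suc b I ks

allFin-suc : ∀ j → allFin (suc j) ≡ Fin.zero ∷ map Fin.suc (allFin j)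
allFin-suc j = cong (Fin.zero ∷_) (sym (LP.map-tabulate id Fin.suc))

members-outside : ∀ {j} (I : Subset j) → members (outside ∷ I) ≡ map Fin.suc (members I)
members-outside {j} I =
  trans (cong (filter (_∈? (outside ∷ I))) (allFin-suc j))
        (filter-∈?-map-suc outside I (allFin j))

members-inside : ∀ {j} (I : Subset j) → members (inside ∷ I) ≡ Fin.zero ∷ map Fin.suc (members I)
members-inside {j} I =
  trans (cong (filter (_∈? (inside ∷ I))) (allFin-suc j))
        (cong (Fin.zero ∷_) (filter-∈?-map-suc inside I (allFin j)))

positions-map-suc : ∀ {j} (ks : List (Fin j)) →
  map (suc ∘ toℕ) (map Fin.suc ks) ≡ map suc (map (suc ∘ toℕ) ks)
positions-map-suc ks = trans (sym (LP.map-∘ ks)) (LP.map-∘ ks)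

elems-outside : ∀ {j} (I : Subset j) → elems (outside ∷ I) ≡ map suc (elems I)
elems-outside I =
  trans (cong (map (suc ∘ toℕ)) (members-outside I)) (positions-map-suc (members I))

elems-inside : ∀ {j} (I : Subset j) → elems (inside ∷ I) ≡ 1 ∷ map suc (elems I)
elems-inside I =
  trans (cong (map (suc ∘ toℕ)) (members-inside I)) (cong (1 ∷_) (positions-map-suc (members I)))

length-elems : ∀ {j} (I : Subset j) → length (elems I) ≡ ∣ I ∣
length-elems []            = refl
length-elems (outside ∷ I) =
  trans (cong length (elems-outside I)) (trans (LP.length-map suc (elems I)) (length-elems I))
length-elems (inside ∷ I)  =
  trans (cong length (elems-inside I)) (cong suc (trans (LP.length-map suc (elems I)) (length-elems I)))

elems-empty : ∀ {j} (I : Subset j) → ∣ I ∣ ≡ 0 → elems I ≡ []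
elems-empty I c = empty (elems I) (trans (length-elems I) c)
  where
  empty : ∀ (l : List ℕ) → length l ≡ 0 → l ≡ []
  empty [] _ = refl

prodOver-outside : ∀ {j} (x : Fin (suc j) → ℤ) (I : Subset j) →
  prodOver x (outside ∷ I) ≡ prodOver (tail x) I
prodOver-outside x I =
  cong (List.foldr _*_ (+ 1)) (trans (cong (map x) (members-outside I)) (sym (LP.map-∘ (members I))))

prodOver-inside : ∀ {j} (x : Fin (suc j) → ℤ) (I : Subset j) →
  prodOver x (inside ∷ I) ≡ head x * prodOver (tail x) I
prodOver-inside x I =
  cong (List.foldr _*_ (+ 1))
       (trans (cong (map x) (members-inside I)) (cong (head x ∷_) (sym (LP.map-∘ (members I)))))

InC-zero : ∀ {j} → InC 0 j ≐ (λ I → ∣ I ∣ ≡ 0 × Even j)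
InC-zero {j} = (λ {I} → to I) , (λ {I} → from I)
  where
  to : ∀ I → InC 0 j I → ∣ I ∣ ≡ 0 × Even j
  to I (c , _ , ev) rewrite elems-empty I c = c , ev
  from : ∀ I → ∣ I ∣ ≡ 0 × Even j → InC 0 j I
  from I (c , ev) rewrite elems-empty I c = c , tt , ev

InC-outside : ∀ {j k} → (λ I → InC (suc k) (suc j) (outside ∷ I)) ≐ InC (suc k) j
InC-outside {j} {k} = (λ {I} → to I) , (λ {I} → from I)
  where
  maxL-eq : ∀ I → ∣ I ∣ ≡ suc k → suc j ∸ maxL (map suc (elems I)) ≡ j ∸ maxL (elems I)
  maxL-eq I c = ∸-maxL-map-suc j (elems I) (trans (length-elems I) c)
  to : ∀ I → InC (suc k) (suc j) (outside ∷ I) → InC (suc k) j I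
  to I (c , co , ev) rewrite elems-outside I =
    c , subst id (ConsecOdd-map-suc (elems I)) co , subst Even (maxL-eq I c) ev
  from : ∀ I → InC (suc k) j I → InC (suc k) (suc j) (outside ∷ I)
  from I (c , co , ev) rewrite elems-outside I =
    c , subst id (sym (ConsecOdd-map-suc (elems I))) co , subst Even (sym (maxL-eq I c)) ev

InC-inside : ∀ {j k} →
  (λ I → InC (suc k) (suc j) (inside ∷ I)) ≐ (λ I → InC k j I × headParity (elems I) ≡ 1ℙ)
InC-inside {j} {k} = (λ {I} → to I) , (λ {I} → from I)
  where
  gap : ∀ I → suc j ∸ maxL (elems (inside ∷ I)) ≡ j ∸ maxL (elems I)
  gap I = trans (cong (λ l → suc j ∸ maxL l) (elems-inside I)) (∸-maxL-1∷ j (elems I))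
  to : ∀ I → InC (suc k) (suc j) (inside ∷ I) → InC k j I × headParity (elems I) ≡ 1ℙ
  to I (c , co , ev) =
    (ℕP.suc-injective c , proj₂ split , subst Even (gap I) ev) , proj₁ split
    where split = ConsecOdd-1∷⁻ (elems I) (subst ConsecOdd (elems-inside I) co)
  from : ∀ I → InC k j I × headParity (elems I) ≡ 1ℙ → InC (suc k) (suc j) (inside ∷ I)
  from I ((c , co , ev) , odd) =
    cong suc c ,
    subst ConsecOdd (sym (elems-inside I)) (ConsecOdd-1∷⁺ (elems I) odd co) ,
    subst Even (sym (gap I)) ev

-- The elements of I ∈ C_{k,j} alternate in parity and the largest is ≡ j.
headParity-elems : ∀ {j k} (I : Subset j) → InC k j I → headParity (elems I) ≡ parity (suc (k ℕ.+ j))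
headParity-elems [] (refl , _) = refl
headParity-elems {suc j} (inside ∷ I) inC@(refl , _) with proj₁ InC-inside {I} inC
... | inC′ , odd = trans (sym odd) (trans (headParity-elems I inC′) (cong parity (sym (ℕP.+-suc ∣ I ∣ j))))
headParity-elems {suc j} {zero} (outside ∷ I) inC with proj₁ InC-zero {outside ∷ I} inC
... | c , ev = begin
  headParity (elems (outside ∷ I)) ≡⟨ cong headParity (elems-empty (outside ∷ I) c) ⟩
  1ℙ                               ≡⟨ cong _⁻¹ (Even⇒parity≡0ℙ (suc j) ev) ⟨
  parity (suc j) ⁻¹                ≡⟨ ℙP.suc-homo-⁻¹ j ⟩
  parity j                         ∎
  where open ≡-Reasoning
headParity-elems {suc j} {suc k} (outside ∷ I) inC = begin
  headParity (elems (outside ∷ I))  ≡⟨ cong headParity (elems-outside I) ⟩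
  headParity (map suc (elems I))    ≡⟨ headParity-map-suc (elems I) (trans (length-elems I) (proj₁ inC)) ⟩
  headParity (elems I) ⁻¹           ≡⟨ cong _⁻¹ (headParity-elems I (proj₁ InC-outside {I} inC)) ⟩
  parity (suc (suc k ℕ.+ j)) ⁻¹     ≡⟨ parity-suc (suc (suc k ℕ.+ j)) ⟨
  parity (suc (suc (suc k ℕ.+ j)))  ≡⟨ cong (parity ∘ suc) (ℕP.+-suc (suc k) j) ⟨
  parity (suc (suc k ℕ.+ suc j))    ∎
  where open ≡-Reasoning

sumℤ-++ : ∀ as bs → sumℤ (as ++ bs) ≡ sumℤ as + sumℤ bs
sumℤ-++ []       bs = sym (ℤP.+-identityˡ (sumℤ bs))
sumℤ-++ (a ∷ as) bs = trans (cong (_+_ a) (sumℤ-++ as bs)) (sym (ℤP.+-assoc a (sumℤ as) (sumℤ bs)))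

sumℤ-map-*ˡ : ∀ {A : Set} c (f : A → ℤ) as → sumℤ (map (λ a → c * f a) as) ≡ c * sumℤ (map f as)
sumℤ-map-*ˡ c f []       = sym (ℤP.*-zeroʳ c)
sumℤ-map-*ˡ c f (a ∷ as) = trans (cong (_+_ (c * f a)) (sumℤ-map-*ˡ c f as)) (sym (ℤP.*-distribˡ-+ c (f a) _))

sumℤ-map-neg : ∀ {A : Set} (f : A → ℤ) as → sumℤ (map (λ a → - f a) as) ≡ - sumℤ (map f as)
sumℤ-map-neg f []       = refl
sumℤ-map-neg f (a ∷ as) = trans (cong (_+_ (- f a)) (sumℤ-map-neg f as)) (sym (ℤP.neg-distrib-+ (f a) _))

filter-map : ∀ {A B : Set} {P : B → Set} (P? : Decidable P) (f : A → B) as →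
  filter P? (map f as) ≡ map f (filter (P? ∘ f) as)
filter-map P? f []       = refl
filter-map P? f (a ∷ as) with does (P? (f a))
... | true  = cong (f a ∷_) (filter-map P? f as)
... | false = filter-map P? f as

sumOver : ∀ {j} {P : Subset j → Set} → Decidable P → (Fin j → ℤ) → ℤ
sumOver {j} P? x = sumℤ (map (prodOver x) (filter P? (allSubsets j)))

sumOver-cong : ∀ {j} {P Q : Subset j → Set} (P? : Decidable P) (Q? : Decidable Q) {x} →
  P ≐ Q → sumOver P? x ≡ sumOver Q? x
sumOver-cong {j} P? Q? {x} P≐Q = cong (sumℤ ∘ map (prodOver x)) (LP.filter-≐ P? Q? P≐Q (allSubsets j))

sumOver-empty : ∀ {j} {P : Subset j → Set} (P? : Decidable P) {x} → (∀ I → ¬ P I) → sumOver P? x ≡ + 0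
sumOver-empty {j} P? {x} ¬P = cong (sumℤ ∘ map (prodOver x)) (LP.filter-none P? (universal ¬P (allSubsets j)))

sumOver-split : ∀ {j} {P : Subset (suc j) → Set} (P? : Decidable P) (x : Fin (suc j) → ℤ) →
  sumOver P? x ≡ head x * sumOver (P? ∘ (inside ∷_)) (tail x) + sumOver (P? ∘ (outside ∷_)) (tail x)
sumOver-split {j} P? x = begin
  sumℤ (map (prodOver x) (filter P? (map (inside ∷_) A ++ map (outside ∷_) A)))
    ≡⟨ cong (sumℤ ∘ map (prodOver x)) (LP.filter-++ P? (map (inside ∷_) A) (map (outside ∷_) A)) ⟩
  sumℤ (map (prodOver x) (filter P? (map (inside ∷_) A) ++ filter P? (map (outside ∷_) A)))
    ≡⟨ cong sumℤ (LP.map-++ (prodOver x) (filter P? (map (inside ∷_) A)) _) ⟩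
  sumℤ (map (prodOver x) (filter P? (map (inside ∷_) A)) ++ map (prodOver x) (filter P? (map (outside ∷_) A)))
    ≡⟨ sumℤ-++ (map (prodOver x) (filter P? (map (inside ∷_) A))) _ ⟩
  part inside + part outside
    ≡⟨ cong₂ _+_ (trans (part-eq inside) (cong sumℤ (LP.map-cong (prodOver-inside x) (filter _ A))))
                 (trans (part-eq outside) (cong sumℤ (LP.map-cong (prodOver-outside x) (filter _ A)))) ⟩
  sumℤ (map (λ I → head x * prodOver (tail x) I) (filter (P? ∘ (inside ∷_)) A))
    + sumOver (P? ∘ (outside ∷_)) (tail x)
    ≡⟨ cong (_+ sumOver (P? ∘ (outside ∷_)) (tail x))
            (sumℤ-map-*ˡ (head x) (prodOver (tail x)) (filter (P? ∘ (inside ∷_)) A)) ⟩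
  head x * sumOver (P? ∘ (inside ∷_)) (tail x) + sumOver (P? ∘ (outside ∷_)) (tail x)
    ∎
  where
  open ≡-Reasoning
  A = allSubsets j
  part : _ → ℤ
  part b = sumℤ (map (prodOver x) (filter P? (map (b ∷_) A)))
  part-eq : ∀ b → part b ≡ sumℤ (map (prodOver x ∘ (b ∷_)) (filter (P? ∘ (b ∷_)) A))
  part-eq b = cong sumℤ (trans (cong (map (prodOver x)) (filter-map P? (b ∷_) A))
                               (sym (LP.map-∘ (filter (P? ∘ (b ∷_)) A))))

sumOver-outside : ∀ {j} {P : Subset (suc j) → Set} (P? : Decidable P) (x : Fin (suc j) → ℤ) →
  (∀ I → ¬ P (inside ∷ I)) → sumOver P? x ≡ sumOver (P? ∘ (outside ∷_)) (tail x)
sumOver-outside P? x ¬P = begin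
  sumOver P? x
    ≡⟨ sumOver-split P? x ⟩
  head x * sumOver (P? ∘ (inside ∷_)) (tail x) + rest
    ≡⟨ cong (λ s → head x * s + rest) (sumOver-empty (P? ∘ (inside ∷_)) ¬P) ⟩
  head x * + 0 + rest
    ≡⟨ cong (_+ rest) (ℤP.*-zeroʳ (head x)) ⟩
  + 0 + rest
    ≡⟨ ℤP.+-identityˡ rest ⟩
  rest
    ∎
  where
  open ≡-Reasoning
  rest = sumOver (P? ∘ (outside ∷_)) (tail x)

γ-vanish : ∀ {i j} (x : Fin j → ℤ) → j < i → γ i j x ≡ + 0
γ-vanish {i} {j} x j<i =
  sumOver-empty (inC? i j) (λ I (c , _) → ℕP.<⇒≱ j<i (subst (_≤ j) c (∣p∣≤n I)))

γ-zero-step : ∀ {j} (x : Fin (suc (suc j)) → ℤ) → γ 0 (suc (suc j)) x ≡ γ 0 j (tail (tail x))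
γ-zero-step {j} x =
  trans (sumOver-outside (inC? 0 (suc (suc j))) x (λ { I (() , _) }))
    (trans (sumOver-outside (inC? 0 (suc (suc j)) ∘ (outside ∷_)) (tail x) (λ { I (() , _) }))
      (sumOver-cong _ (inC? 0 j) zero≐))
  where
  zero≐ : (λ I → InC 0 (suc (suc j)) (outside ∷ outside ∷ I)) ≐ InC 0 j
  zero≐ = (λ {I} c → proj₂ InC-zero (proj₁ InC-zero {outside ∷ outside ∷ I} c))
        , (λ {I} c → proj₂ InC-zero {outside ∷ outside ∷ I} (proj₁ InC-zero {I} c))

γ-step-sameParity : ∀ {j k} (x : Fin (suc j) → ℤ) → parity k ≡ parity j →
  γ (suc k) (suc j) x ≡ head x * γ k j (tail x) + γ (suc k) j (tail x)
γ-step-sameParity {j} {k} x same =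
  trans (sumOver-split (inC? (suc k) (suc j)) x)
        (cong₂ (λ a b → head x * a + b) (sumOver-cong _ (inC? k j) inside≐)
                                        (sumOver-cong _ (inC? (suc k) j) InC-outside))
  where
  odd : parity (suc (k ℕ.+ j)) ≡ 1ℙ
  odd = trans (parity-suc-+ k j) (cong _⁻¹ (trans (cong (ℙ._+ parity j) same) (ℙP.p+p≡0ℙ (parity j))))
  inside≐ : (λ I → InC (suc k) (suc j) (inside ∷ I)) ≐ InC k j
  inside≐ = (λ {I} c → proj₁ (proj₁ InC-inside {I} c))
          , (λ {I} c → proj₂ InC-inside {I} (c , trans (headParity-elems I c) odd))

γ-step-oppParity : ∀ {j k} (x : Fin (suc j) → ℤ) → parity k ≡ parity j ⁻¹ →
  γ (suc k) (suc j) x ≡ γ (suc k) j (tail x)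
γ-step-oppParity {j} {k} x opp =
  trans (sumOver-outside (inC? (suc k) (suc j)) x no-inside) (sumOver-cong _ (inC? (suc k) j) InC-outside)
  where
  even : parity (suc (k ℕ.+ j)) ≡ 0ℙ
  even = trans (parity-suc-+ k j) (cong _⁻¹ (trans (cong (ℙ._+ parity j) opp) (ℙP.p⁻¹+p≡1ℙ (parity j))))
  no-inside : ∀ I → ¬ InC (suc k) (suc j) (inside ∷ I)
  no-inside I c with proj₁ InC-inside {I} c
  ... | c′ , odd with trans (sym even) (trans (sym (headParity-elems I c′)) odd)
  ... | ()

γ-recurrence : ∀ {j k} (x : Fin (suc (suc j)) → ℤ) → parity (suc k) ≡ parity j →
  γ (suc k) (suc (suc j)) x ≡ head x * γ k (suc j) (tail x) + γ (suc k) j (tail (tail x))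
γ-recurrence {j} {k} x p =
  trans (γ-step-sameParity x (trans opp (sym (parity-suc j))))
        (cong (_+_ (head x * γ k (suc j) (tail x))) (γ-step-oppParity (tail x) opp))
  where
  opp : parity k ≡ parity j ⁻¹
  opp = trans (sym (ℙP.suc-homo-⁻¹ k)) (cong _⁻¹ p)

signedSum : (ℕ → ℤ) → ℕ → ℕ → ℤ
signedSum t n k = sumℤ (map (λ m → sgn m * t (n ∸ 2 ℕ.* m)) (upTo k))

sumℤ-upTo-suc : ∀ (f : ℕ → ℤ) k → sumℤ (map f (upTo (suc k))) ≡ f 0 + sumℤ (map (f ∘ suc) (upTo k))
sumℤ-upTo-suc f k =
  cong (_+_ (f 0) ∘ sumℤ) (trans (LP.map-applyUpTo suc f k) (sym (LP.map-applyUpTo id (f ∘ suc) k)))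

signedSum-suc : ∀ t n k → signedSum t n (suc k) ≡ t n - signedSum t (n ∸ 2) k
signedSum-suc t n k = begin
  signedSum t n (suc k)
    ≡⟨ sumℤ-upTo-suc (λ m → sgn m * t (n ∸ 2 ℕ.* m)) k ⟩
  + 1 * t n + sumℤ (map (λ m → - sgn m * t (n ∸ 2 ℕ.* suc m)) (upTo k))
    ≡⟨ cong₂ _+_ (ℤP.*-identityˡ (t n)) (cong sumℤ (LP.map-cong term (upTo k))) ⟩
  t n + sumℤ (map (λ m → - (sgn m * t ((n ∸ 2) ∸ 2 ℕ.* m))) (upTo k))
    ≡⟨ cong (_+_ (t n)) (sumℤ-map-neg (λ m → sgn m * t ((n ∸ 2) ∸ 2 ℕ.* m)) (upTo k)) ⟩
  t n - signedSum t (n ∸ 2) k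
    ∎
  where
  open ≡-Reasoning
  term : ∀ m → - sgn m * t (n ∸ 2 ℕ.* suc m) ≡ - (sgn m * t ((n ∸ 2) ∸ 2 ℕ.* m))
  term m = trans (cong (λ i → - sgn m * t (n ∸ i)) (ℕP.*-suc 2 m))
                 (trans (cong (λ i → - sgn m * t i) (sym (ℕP.∸-+-assoc n 2 (2 ℕ.* m))))
                        (sym (ℤP.neg-distribˡ-* (sgn m) _)))

altSum : (ℕ → ℤ) → ℕ → ℤ
altSum t zero          = t zero
altSum t (suc zero)    = t (suc zero)
altSum t (suc (suc n)) = t (suc (suc n)) - altSum t n

signedSum≡altSum : ∀ t n → signedSum t n (suc (n ℕ./ 2)) ≡ altSum t n
signedSum≡altSum t zero          = trans (signedSum-suc t 0 0) (ℤP.+-identityʳ (t 0))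
signedSum≡altSum t (suc zero)    = trans (signedSum-suc t 1 0) (ℤP.+-identityʳ (t 1))
signedSum≡altSum t (suc (suc n)) = begin
  signedSum t (suc (suc n)) (suc (suc (suc n) ℕ./ 2))
    ≡⟨ cong (signedSum t (suc (suc n)) ∘ suc) (m/n≡1+[m∸n]/n {suc (suc n)} {2} (ℕ.s≤s (ℕ.s≤s ℕ.z≤n))) ⟩
  signedSum t (suc (suc n)) (suc (suc (n ℕ./ 2)))
    ≡⟨ signedSum-suc t (suc (suc n)) (suc (n ℕ./ 2)) ⟩
  t (suc (suc n)) - signedSum t n (suc (n ℕ./ 2))
    ≡⟨ cong (_-_ (t (suc (suc n)))) (signedSum≡altSum t n) ⟩
  altSum t (suc (suc n))
    ∎
  where open ≡-Reasoning

altSum-linear : ∀ {t u v : ℕ → ℤ} c n → (∀ i → parity i ≡ parity n → t i ≡ c * u i + v i) →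
  altSum t n ≡ c * altSum u n + altSum v n
altSum-linear c zero          t≡ = t≡ 0 refl
altSum-linear c (suc zero)    t≡ = t≡ 1 refl
altSum-linear {t} {u} {v} c (suc (suc n)) t≡ =
  trans (cong₂ _-_ (t≡ (suc (suc n)) refl) (altSum-linear c n t≡))
        (ring c (u (suc (suc n))) (v (suc (suc n))) (altSum u n) (altSum v n))
  where
  ring : ∀ c a b A B → (c * a + b) - (c * A + B) ≡ c * (a - A) + (b - B)
  ring = solve-∀

altSum-suc : ∀ (t : ℕ → ℤ) n → t 0 ≡ + 0 → altSum t (suc n) ≡ altSum (t ∘ suc) n
altSum-suc t zero          t₀ = refl
altSum-suc t (suc zero)    t₀ = trans (cong (_-_ (t 2)) t₀) (ℤP.+-identityʳ (t 2))
altSum-suc t (suc (suc n)) t₀ = cong (_-_ (t (suc (suc (suc n))))) (altSum-suc t n t₀)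

G≡altSum : ∀ n (x : Fin n → ℤ) → G n x ≡ altSum (λ i → γ i n x) n
G≡altSum n x = signedSum≡altSum (λ i → γ i n x) n

G-recurrence : ∀ j (x : Fin (suc (suc j)) → ℤ) →
  G (suc (suc j)) x ≡ head x * G (suc j) (tail x) - G j (tail (tail x))
G-recurrence j x = begin
  G (suc (suc j)) x
    ≡⟨ G≡altSum (suc (suc j)) x ⟩
  altSum (λ i → γ i (suc (suc j)) x) (suc (suc j))
    ≡⟨ altSum-linear (head x) (suc (suc j)) termwise ⟩
  head x * altSum shifted (suc (suc j)) + (γ (suc (suc j)) j x″ - altSum (λ i → γ i j x″) j)
    ≡⟨ cong₂ (λ a b → head x * a + (b - altSum (λ i → γ i j x″) j))
             (altSum-suc shifted (suc j) refl) (γ-vanish x″ (ℕP.m<n+m j (ℕ.s≤s ℕ.z≤n))) ⟩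
  head x * altSum (λ i → γ i (suc j) (tail x)) (suc j) + (+ 0 - altSum (λ i → γ i j x″) j)
    ≡⟨ cong₂ (λ a b → head x * a + b) (sym (G≡altSum (suc j) (tail x)))
             (trans (ℤP.+-identityˡ _) (cong -_ (sym (G≡altSum j x″)))) ⟩
  head x * G (suc j) (tail x) - G j x″
    ∎
  where
  open ≡-Reasoning
  x″ = tail (tail x)
  shifted : ℕ → ℤ
  shifted zero    = + 0
  shifted (suc k) = γ k (suc j) (tail x)
  termwise : ∀ i → parity i ≡ parity j → γ i (suc (suc j)) x ≡ head x * shifted i + γ i j x″
  termwise zero    _ = begin
    γ 0 (suc (suc j)) x         ≡⟨ γ-zero-step x ⟩
    γ 0 j x″                    ≡⟨ ℤP.+-identityˡ (γ 0 j x″) ⟨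
    + 0 + γ 0 j x″              ≡⟨ cong (_+ γ 0 j x″) (ℤP.*-zeroʳ (head x)) ⟨
    head x * + 0 + γ 0 j x″     ∎
  termwise (suc k) p = γ-recurrence x p

G≡continuant : ∀ n (x : Fin n → ℤ) → G n x ≡ continuant n x
G≡continuant zero          x = refl
G≡continuant (suc zero)    x = trans (G≡altSum 1 x) (trans (ℤP.+-identityʳ _) (ℤP.*-identityʳ (head x)))
G≡continuant (suc (suc n)) x =
  trans (G-recurrence n x)
        (cong₂ (λ a b → head x * a - b) (G≡continuant (suc n) (tail x)) (G≡continuant n (tail (tail x))))

theorem3 : (n : ℕ) → (x : Fin (suc n) → ℤ) → G (suc n) x ≡ F (suc n) x
theorem3 n x = trans (G≡continuant (suc n) x) (sym (F'≡continuant n x))
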